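{- Let $G_1$ and $G_2$ be nontrivial (not necessarily distinct) subgroups of the multiplicative group $\mathbb{F}_q^\ast$ of a finite field $\mathbb{F}_q$. For any $a\in\mathbb{F}_q$ and $b\in\mathbb{F}_q^\ast$, we have $aG_1+b\neq G_2$, where $aG_1+b=\{ag+b : g\in G_1\}$. -}

module Defs where

open import Level using (Level; _⊔_) renaming (suc to lsuc)
open import Algebra.Bundles using (CommutativeRing)
open import Data.Nat using (ℕ)
open import Data.Fin using (Fin)
open import Data.Product using (Σ; ∃; _×_)
open import Relation.Binary.PropositionalEquality using (_≡_)
open import Relation.Nullary using (¬_)

record FiniteField (c ℓ : Level) : Set (lsuc (c ⊔ ℓ)) where
  field
    commutativeRing : CommutativeRing c ℓ
  open CommutativeRing commutativeRing public
  field
    1≉0       : ¬ (1# ≈ 0#)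
    inverse   : ∀ x → ¬ (x ≈ 0#) → ∃ λ y → x * y ≈ 1#
    size      : ℕ
    enum      : Fin size → Carrier
    enum-surj : ∀ x → ∃ λ i → enum i ≈ x
    enum-inj  : ∀ i j → enum i ≈ enum j → i ≡ j

module _ {c ℓ : Level} (F : FiniteField c ℓ) where
  open FiniteField F

  record IsMulSubgroup {p : Level} (H : Carrier → Set p) : Set (c ⊔ ℓ ⊔ p) where
    field
      respects : ∀ {x y} → x ≈ y → H x → H y
      nonzero  : ∀ {x} → H x → ¬ (x ≈ 0#)
      has-one  : H 1#
      closed-* : ∀ {x y} → H x → H y → H (x * y)
      closed-⁻¹ : ∀ {x} → H x → ∃ λ y → H y × (x * y ≈ 1#)

  Nontrivial : {p : Level} → (Carrier → Set p) → Set (c ⊔ ℓ ⊔ p)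
  Nontrivial H = ∃ λ x → H x × ¬ (x ≈ 1#)

  AffineImageEq : {p : Level} → Carrier → (Carrier → Set p) → Carrier → (Carrier → Set p) → Set (c ⊔ ℓ ⊔ p)
  AffineImageEq a G₁ b G₂ =
    (∀ y → (∃ λ g → G₁ g × (y ≈ a * g + b)) → G₂ y) ×
    (∀ y → G₂ y → ∃ λ g → G₁ g × (y ≈ a * g + b))

-- Suppose a·G₁ + b = G₂ with b ≠ 0. Then G₂ is stable under the dilations
-- y ↦ h y with centre 0 and ratio h ∈ G₂, and under the dilations
-- y ↦ g (y − b) + b with centre b and ratio g ∈ G₁. For g ≠ 1 ≠ h the
-- commutator of two such dilations is the translation by
-- t = (g⁻¹ − 1)(h − 1) b ≠ 0, so t is a period of G₂. The periods of a
-- multiplicative subgroup G form an additive group (the field has positive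
-- characteristic) which is closed under multiplication, because 1 + u ∈ G
-- for every period u and (1 + u) s − s = u s. In a finite field t has finite
-- multiplicative order, so 1 and hence −1 would be a period of G, putting
-- 0 = 1 + (−1) into G: a contradiction.

module Submission where

open import Defs
open import Level using (Level; _⊔_)
open import Data.Nat using (ℕ; zero; suc) renaming (_+_ to _+ℕ_)
open import Data.Nat.Properties using (n<1+n; m≤n⇒∃[o]m+o≡n; +-suc)
open import Data.Fin using (Fin; toℕ)
open import Data.Fin.Properties using (pigeonhole)
open import Data.Product using (∃; ∃₂; _,_; proj₁; proj₂)
open import Relation.Binary.PropositionalEquality as ≡ using (_≡_)
open import Relation.Nullary using (¬_)

module FiniteFieldProperties {c ℓ : Level} (F : FiniteField c ℓ) where
  open FiniteField F
  open import Algebra.Properties.Semiring.Mult semiring using (×-homo-+; ×-congʳ; ×-assoc-*) renaming (_×_ to _×ℕ_)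
  open import Algebra.Properties.Semiring.Exp semiring using (_^_; ^-homo-*)
  open import Algebra.Properties.Group +-group
    using (identityʳ-unique; inverseʳ-unique; x∙y⁻¹≈ε⇒x≈y; //-rightDividesˡ)
    renaming (∙-cancelʳ to +-cancelʳ)
  open import Algebra.Properties.AbelianGroup +-abelianGroup using (xyx⁻¹≈y)
  open import Algebra.Solver.Ring.NaturalCoefficients.Default commutativeSemiring
  open import Relation.Binary.Reasoning.Setoid setoid

  *-cancelˡ-≉0 : ∀ {x} y z → ¬ x ≈ 0# → x * y ≈ x * z → y ≈ z
  *-cancelˡ-≉0 {x} y z x≉0 xy≈xz with x⁻¹ , xx⁻¹≈1 ← inverse x x≉0 = begin
    y              ≈⟨ x⁻¹[xw]≈w y ⟨
    x⁻¹ * (x * y)  ≈⟨ *-congˡ xy≈xz ⟩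
    x⁻¹ * (x * z)  ≈⟨ x⁻¹[xw]≈w z ⟩
    z              ∎
    where
    x⁻¹[xw]≈w : ∀ w → x⁻¹ * (x * w) ≈ w
    x⁻¹[xw]≈w w = begin
      x⁻¹ * (x * w)  ≈⟨ *-assoc x⁻¹ x w ⟨
      (x⁻¹ * x) * w  ≈⟨ *-congʳ (trans (*-comm x⁻¹ x) xx⁻¹≈1) ⟩
      1# * w         ≈⟨ *-identityˡ w ⟩
      w              ∎

  *-≉0 : ∀ {x y} → ¬ x ≈ 0# → ¬ y ≈ 0# → ¬ x * y ≈ 0#
  *-≉0 {x} {y} x≉0 y≉0 xy≈0 = y≉0 (*-cancelˡ-≉0 y 0# x≉0 (trans xy≈0 (sym (zeroʳ x))))

  ^-≉0 : ∀ {x} → ¬ x ≈ 0# → ∀ n → ¬ x ^ n ≈ 0#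
  ^-≉0 x≉0 zero    = 1≉0
  ^-≉0 x≉0 (suc n) = *-≉0 x≉0 (^-≉0 x≉0 n)

  x≉y⇒x-y≉0 : ∀ {x y} → ¬ x ≈ y → ¬ x - y ≈ 0#
  x≉y⇒x-y≉0 x≉y x-y≈0 = x≉y (x∙y⁻¹≈ε⇒x≈y _ _ x-y≈0)

  x*y≈1∧x≉1⇒y≉1 : ∀ {x y} → x * y ≈ 1# → ¬ x ≈ 1# → ¬ y ≈ 1#
  x*y≈1∧x≉1⇒y≉1 {x} {y} xy≈1 x≉1 y≈1 =
    x≉1 (trans (sym (*-identityʳ x)) (trans (*-congˡ (sym y≈1)) xy≈1))

  [x-1][y-1]z+xz+yz≈xyz+z : ∀ x y z → (x - 1#) * ((y - 1#) * z) + (x * z + y * z) ≈ x * y * z + z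
  [x-1][y-1]z+xz+yz≈xyz+z x y z = begin
    u * (v * z) + (x * z + y * z)                ≈⟨ +-congˡ (+-cong (*-congʳ x≈u+1) (*-congʳ y≈v+1)) ⟩
    u * (v * z) + ((u + 1#) * z + (v + 1#) * z)
      ≈⟨ solve 3 (λ u v z → u :* (v :* z) :+ ((u :+ con 1) :* z :+ (v :+ con 1) :* z)
                           := (u :+ con 1) :* (v :+ con 1) :* z :+ z) refl u v z ⟩
    (u + 1#) * (v + 1#) * z + z                  ≈⟨ +-congʳ (*-congʳ (*-cong x≈u+1 y≈v+1)) ⟨
    x * y * z + z                                ∎
    where
    u = x - 1#
    v = y - 1#
    x≈u+1 : x ≈ u + 1#
    x≈u+1 = sym (//-rightDividesˡ 1# x)
    y≈v+1 : y ≈ v + 1#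
    y≈v+1 = sym (//-rightDividesˡ 1# y)

  index : Carrier → Fin size
  index x = proj₁ (enum-surj x)

  index-injective : ∀ {x y} → index x ≡ index y → x ≈ y
  index-injective {x} {y} same = begin
    x               ≈⟨ proj₂ (enum-surj x) ⟨
    enum (index x)  ≡⟨ ≡.cong enum same ⟩
    enum (index y)  ≈⟨ proj₂ (enum-surj y) ⟩
    y               ∎

  sequence-repeats : (f : ℕ → Carrier) → ∃₂ λ i d → f i ≈ f (i +ℕ suc d)
  sequence-repeats f
    with i , j , i<j , same ← pigeonhole (n<1+n size) (λ k → index (f (toℕ k)))
    with d , 1+i+d≡j ← m≤n⇒∃[o]m+o≡n i<j
    = toℕ i , d , trans (index-injective same) (reflexive (≡.cong f j≡i+1+d))
    where
    j≡i+1+d : toℕ j ≡ toℕ i +ℕ suc d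
    j≡i+1+d = ≡.sym (≡.trans (+-suc (toℕ i) d) 1+i+d≡j)

  positive-characteristic : ∃ λ m → suc m ×ℕ 1# ≈ 0#
  positive-characteristic with i , d , repeat ← sequence-repeats (_×ℕ 1#) =
    d , identityʳ-unique (i ×ℕ 1#) (suc d ×ℕ 1#) (sym (trans repeat (×-homo-+ 1# i (suc d))))

  finite-order : ∀ {x} → ¬ x ≈ 0# → ∃ λ d → x ^ suc d ≈ 1#
  finite-order {x} x≉0 with i , d , repeat ← sequence-repeats (x ^_) =
    d , *-cancelˡ-≉0 (x ^ suc d) 1# (^-≉0 x≉0 i) (begin
      x ^ i * x ^ suc d  ≈⟨ ^-homo-* x i (suc d) ⟨
      x ^ (i +ℕ suc d)   ≈⟨ repeat ⟨
      x ^ i              ≈⟨ *-identityʳ (x ^ i) ⟨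
      x ^ i * 1#         ∎)

  -x≈m×x : ∀ m → suc m ×ℕ 1# ≈ 0# → ∀ x → - x ≈ m ×ℕ x
  -x≈m×x m char x = sym (inverseʳ-unique x (m ×ℕ x) (begin
    suc m ×ℕ x          ≈⟨ ×-congʳ (suc m) (*-identityˡ x) ⟨
    suc m ×ℕ (1# * x)   ≈⟨ ×-assoc-* (suc m) 1# x ⟨
    (suc m ×ℕ 1#) * x   ≈⟨ *-congʳ char ⟩
    0# * x              ≈⟨ zeroˡ x ⟩
    0#                  ∎))

  Period : ∀ {p} → (Carrier → Set p) → Carrier → Set (c ⊔ p)
  Period G s = ∀ {y} → G y → G (y + s)

  module PeriodsOfMulSubgroup {p} {G : Carrier → Set p} (G-subgroup : IsMulSubgroup F G) where
    open IsMulSubgroup G-subgroup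

    period-cong : ∀ {s s′} → s ≈ s′ → Period G s → Period G s′
    period-cong s≈s′ per Gy = respects (+-congˡ s≈s′) (per Gy)

    period-+ : ∀ {s u} → Period G s → Period G u → Period G (s + u)
    period-+ {s} {u} per-s per-u {y} Gy = respects (+-assoc y s u) (per-u (per-s Gy))

    period-× : ∀ {s} → Period G s → ∀ n → Period G (n ×ℕ s)
    period-× per zero    {y} Gy = respects (sym (+-identityʳ y)) Gy
    period-× per (suc n)        = period-+ per (period-× per n)

    period-neg : ∀ {s} → Period G s → Period G (- s)
    period-neg {s} per with m , char ← positive-characteristic =
      period-cong (sym (-x≈m×x m char s)) (period-× per m)

    period-*ˡ : ∀ {h s} → G h → Period G s → Period G (h * s)
    period-*ˡ {h} {s} Gh per {y} Gy with h⁻¹ , Gh⁻¹ , hh⁻¹≈1 ← closed-⁻¹ Gh =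
      respects h[h⁻¹y+s]≈y+hs (closed-* Gh (per (closed-* Gh⁻¹ Gy)))
      where
      h[h⁻¹y+s]≈y+hs : h * (h⁻¹ * y + s) ≈ y + h * s
      h[h⁻¹y+s]≈y+hs = begin
        h * (h⁻¹ * y + s)        ≈⟨ distribˡ h (h⁻¹ * y) s ⟩
        h * (h⁻¹ * y) + h * s    ≈⟨ +-congʳ (*-assoc h h⁻¹ y) ⟨
        (h * h⁻¹) * y + h * s    ≈⟨ +-congʳ (*-congʳ hh⁻¹≈1) ⟩
        1# * y + h * s           ≈⟨ +-congʳ (*-identityˡ y) ⟩
        y + h * s                ∎

    period-* : ∀ {u s} → Period G u → Period G s → Period G (u * s)
    period-* {u} {s} per-u per-s =
      period-cong [1+u]s-s≈us (period-+ (period-*ˡ (per-u has-one) per-s) (period-neg per-s))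
      where
      [1+u]s-s≈us : (1# + u) * s + - s ≈ u * s
      [1+u]s-s≈us = begin
        (1# + u) * s + - s       ≈⟨ +-congʳ (distribʳ s 1# u) ⟩
        (1# * s + u * s) + - s   ≈⟨ +-congʳ (+-congʳ (*-identityˡ s)) ⟩
        (s + u * s) + - s        ≈⟨ xyx⁻¹≈y s (u * s) ⟩
        u * s                    ∎

    period-^ : ∀ {t} → Period G t → ∀ n → Period G (t ^ suc n)
    period-^ per zero    = period-cong (sym (*-identityʳ _)) per
    period-^ per (suc n) = period-* per (period-^ per n)

    nonzero-not-period : ∀ {t} → ¬ t ≈ 0# → ¬ Period G t
    nonzero-not-period t≉0 per with d , t^[1+d]≈1 ← finite-order t≉0 =
      nonzero (respects (-‿inverseʳ 1#) (period-neg 1-period has-one)) refl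
      where
      1-period : Period G 1#
      1-period = period-cong t^[1+d]≈1 (period-^ per d)

  module AffineImage {p} {G₁ G₂ : Carrier → Set p}
                     (G₁-subgroup : IsMulSubgroup F G₁) (G₂-subgroup : IsMulSubgroup F G₂)
                     {a b : Carrier} (image : AffineImageEq F a G₁ b G₂) where
    private
      module G₁ = IsMulSubgroup G₁-subgroup
      module G₂ = IsMulSubgroup G₂-subgroup

    -- The dilation z = k (y − b) + b, stated without subtraction.
    dilation-about-b : ∀ {k y z} → G₁ k → G₂ y → z + k * b ≈ k * y + b → G₂ z
    dilation-about-b {k} {y} {z} Gk Gy z+kb≈ky+b with g , Gg , y≈ag+b ← proj₂ image y Gy =
      proj₁ image z (k * g , G₁.closed-* Gk Gg , +-cancelʳ (k * b) z (a * (k * g) + b) (begin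
        z + k * b                  ≈⟨ z+kb≈ky+b ⟩
        k * y + b                  ≈⟨ +-congʳ (*-congˡ y≈ag+b) ⟩
        k * (a * g + b) + b
          ≈⟨ solve 4 (λ k a g b → k :* (a :* g :+ b) :+ b := (a :* (k :* g) :+ b) :+ k :* b) refl k a g b ⟩
        (a * (k * g) + b) + k * b  ∎))

    commutator-period : ∀ {g g′ h h′} → G₁ g → G₁ g′ → g * g′ ≈ 1# → G₂ h → G₂ h′ → h * h′ ≈ 1# →
                        Period G₂ ((g′ - 1#) * ((h - 1#) * b))
    commutator-period {g} {g′} {h} {h′} Gg Gg′ gg′≈1 Gh Gh′ hh′≈1 {y} Gy =
      dilation-about-b Gg′ (G₂.closed-* Gh Gy₂)
        (+-cancelʳ (h * b) _ _ (trans [y+t]+g′b+hb≈y+[g′hb+b] (sym g′[hy₂]+b+hb≈y+[g′hb+b])))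
      where
      t : Carrier
      t = (g′ - 1#) * ((h - 1#) * b)

      -- y₂ = g (h′ y − b) + b; the goal (y + t) + g′ b ≈ g′ (h y₂) + b is checked after adding h b.
      y₂ : Carrier
      y₂ = (g * (h′ * y) + b) - g * b

      y₂+gb≈g[h′y]+b : y₂ + g * b ≈ g * (h′ * y) + b
      y₂+gb≈g[h′y]+b = //-rightDividesˡ (g * b) (g * (h′ * y) + b)

      Gy₂ : G₂ y₂
      Gy₂ = dilation-about-b Gg (G₂.closed-* Gh′ Gy) y₂+gb≈g[h′y]+b

      [y+t]+g′b+hb≈y+[g′hb+b] : ((y + t) + g′ * b) + h * b ≈ y + (g′ * h * b + b)
      [y+t]+g′b+hb≈y+[g′hb+b] = begin
        ((y + t) + g′ * b) + h * b
          ≈⟨ solve 4 (λ y t u v → ((y :+ t) :+ u) :+ v := y :+ (t :+ (u :+ v))) refl y t (g′ * b) (h * b) ⟩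
        y + (t + (g′ * b + h * b))   ≈⟨ +-congˡ ([x-1][y-1]z+xz+yz≈xyz+z g′ h b) ⟩
        y + (g′ * h * b + b)         ∎

      g′[hy₂]+b+hb≈y+[g′hb+b] : (g′ * (h * y₂) + b) + h * b ≈ y + (g′ * h * b + b)
      g′[hy₂]+b+hb≈y+[g′hb+b] = begin
        (g′ * (h * y₂) + b) + h * b                    ≈⟨ +-congˡ (trans (*-congʳ (*-congʳ gg′≈1)) (*-congʳ (*-identityˡ h))) ⟨
        (g′ * (h * y₂) + b) + (g * g′) * h * b
          ≈⟨ solve 5 (λ g g′ h y₂ b → (g′ :* (h :* y₂) :+ b) :+ (g :* g′) :* h :* b
                                     := g′ :* h :* (y₂ :+ g :* b) :+ b) refl g g′ h y₂ b ⟩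
        g′ * h * (y₂ + g * b) + b                      ≈⟨ +-congʳ (*-congˡ y₂+gb≈g[h′y]+b) ⟩
        g′ * h * (g * (h′ * y) + b) + b
          ≈⟨ solve 6 (λ g g′ h h′ y b → g′ :* h :* (g :* (h′ :* y) :+ b) :+ b
                                     := (g :* g′) :* (h :* h′) :* y :+ (g′ :* h :* b :+ b)) refl g g′ h h′ y b ⟩
        (g * g′) * (h * h′) * y + (g′ * h * b + b)     ≈⟨ +-congʳ (*-congʳ (*-cong gg′≈1 hh′≈1)) ⟩
        1# * 1# * y + (g′ * h * b + b)                 ≈⟨ +-congʳ (trans (*-congʳ (*-identityˡ 1#)) (*-identityˡ y)) ⟩
        y + (g′ * h * b + b)                           ∎

lemma1 : {c ℓ p : Level} (F : FiniteField c ℓ) (G₁ G₂ : FiniteField.Carrier F → Set p) → IsMulSubgroup F G₁ → Nontrivial F G₁ → IsMulSubgroup F G₂ → Nontrivial F G₂ → (a b : FiniteField.Carrier F) → ¬ (FiniteField._≈_ F b (FiniteField.0# F)) → ¬ AffineImageEq F a G₁ b G₂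
lemma1 F G₁ G₂ G₁-subgroup (g , Gg , g≉1) G₂-subgroup (h , Gh , h≉1) a b b≉0 image
  with g⁻¹ , Gg⁻¹ , gg⁻¹≈1 ← IsMulSubgroup.closed-⁻¹ G₁-subgroup Gg
     | h⁻¹ , Gh⁻¹ , hh⁻¹≈1 ← IsMulSubgroup.closed-⁻¹ G₂-subgroup Gh
  = nonzero-not-period t≉0 (commutator-period Gg Gg⁻¹ gg⁻¹≈1 Gh Gh⁻¹ hh⁻¹≈1)
  where
  open FiniteField F
  open FiniteFieldProperties F
  open PeriodsOfMulSubgroup G₂-subgroup
  open AffineImage G₁-subgroup G₂-subgroup image

  t≉0 : ¬ (g⁻¹ - 1#) * ((h - 1#) * b) ≈ 0#
  t≉0 = *-≉0 (x≉y⇒x-y≉0 (x*y≈1∧x≉1⇒y≉1 gg⁻¹≈1 g≉1)) (*-≉0 (x≉y⇒x-y≉0 h≉1) b≉0)
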